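{- Let $T$ be a $\beta(1,0)$-tree and let $\Phi(T)$ be the rooted non-separable planar map corresponding to $T$ under the Cori–Jacquard–Schaeffer bijection $\Phi$ described in the context. Then $\Phi(T)$ is primitive if and only if $T$ has no node which has exactly one child whose label equals that child's maximum possible label. Moreover, the number of internal $2$-faces of $\Phi(T)$ equals the number of non-root nodes $u$ of $T$ such that $u$ is the only child of its parent and the label of $u$ equals its maximum possible label.
   Context: A rooted non-separable planar map (here simply "map") is a planar map with no loops and no cut vertices (a cut vertex is a vertex $v$ such that the edge set can be partitioned into two nonempty parts with $v$ the unique vertex incident to edges of both parts), with a distinguished directed edge (the root edge); its tail is the root vertex and the face to the right of the root edge is the root face, assumed to be the outer face. Maps are considered up to orientation-preserving homeomorphism. A $k$-face is a face of degree $k$. An internal $2$-face is a $2$-face other than the root face. A map is primitive if it has no internal $2$-face. A $\beta(1,0)$-tree is a rooted plane tree whose nodes carry positive integer labels such that every leaf has label $1$, the root has label equal to the sum of its children's labels, and every other internal node has label at most the sum of its children's labels. The maximum possible label of a non-root node $u$ is $1$ if $u$ is a leaf and the sum of the labels of its children otherwise. The bijection $\Phi$: for each node $v$ of $T$ define recursively a map $M(v)$ with two distinguished vertices on its outer face, a root vertex $R$ and a marked vertex $\star$. If $v$ is a leaf, $M(v)$ is a single edge directed from $R$ to $\star$. If $v$ has label $i$ and children $u_1,\dots,u_m$ from left to right, identify the $\star$-vertex of $M(u_j)$ with the $R$-vertex of $M(u_{j+1})$ for $j=1,\dots,m-1$, then add in the outer face a new edge directed from the $\star$-vertex of $M(u_m)$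 to the $R$-vertex of $M(u_1)$; this new edge is the new root edge and its tail the new root vertex $R$; finally (unless $v$ is the root of $T$) mark as $\star$ the $i$-th vertex met when going counterclockwise around the outer face starting from, but not counting, $R$. Then $\Phi(T)=M(\text{root of }T)$. $\Phi$ is a bijection between $\beta(1,0)$-trees with $n$ edges and maps with $n+1$ edges. -}

module Defs where

open import Data.Nat using (ℕ; zero; suc; _+_; _*_; _∸_; _≤_; _<_; _≡ᵇ_; _<ᵇ_)
open import Data.Bool using (Bool; true; false; if_then_else_; _∧_; not; _∨_)
open import Data.List using (List; []; _∷_)
open import Data.List.Relation.Unary.Any using (Any)
open import Data.Product using (_×_)
open import Data.Unit using (⊤)
open import Relation.Binary.PropositionalEquality using (_≡_)

data Tree : Set where
  node : ℕ → List Tree → Tree   -- label, children from left to right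

label : Tree → ℕ
label (node i _) = i

sumLabels : List Tree → ℕ
sumLabels []       = 0
sumLabels (t ∷ ts) = label t + sumLabels ts

maxLabel : Tree → ℕ
maxLabel (node _ [])       = 1
maxLabel (node _ (c ∷ cs)) = sumLabels (c ∷ cs)

mutual
  NonRootOK : Tree → Set
  NonRootOK (node i [])       = i ≡ 1
  NonRootOK (node i (c ∷ cs)) = (1 ≤ i) × (i ≤ sumLabels (c ∷ cs)) × AllOK (c ∷ cs)

  AllOK : List Tree → Set
  AllOK []       = ⊤
  AllOK (t ∷ ts) = NonRootOK t × AllOK ts

IsBeta10 : Tree → Set
IsBeta10 (node i cs) = (1 ≤ i) × (i ≡ sumLabels cs) × (cs ≡ [] → i ≡ 1) × AllOK cs

data HasBad : Tree → Set where
  here  : ∀ {i u} → label u ≡ maxLabel u → HasBad (node i (u ∷ []))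
  there : ∀ {i cs} → Any HasBad cs → HasBad (node i cs)

mutual
  countOnlyMax : Tree → ℕ
  countOnlyMax (node i [])           = 0
  countOnlyMax (node i (u ∷ []))     =
    (if label u ≡ᵇ maxLabel u then 1 else 0) + countOnlyMax u
  countOnlyMax (node i (u ∷ v ∷ cs)) = countOnlyMaxL (u ∷ v ∷ cs)

  countOnlyMaxL : List Tree → ℕ
  countOnlyMaxL []       = 0
  countOnlyMaxL (t ∷ ts) = countOnlyMax t + countOnlyMaxL ts

-- A map with e edges has darts 0 … 2e-1; edge k consists of the darts
-- 2k and 2k+1, and the edge involution is `flip`.  σ sends a dart to the
-- next dart counterclockwise around its tail vertex.  The face permutation
-- φ = σ ∘ flip follows the face lying to the right of a dart; on the
-- outer face this walks counterclockwise around the map.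
-- `root` is the root dart (tail = root vertex R; the root face is the
-- φ-orbit of `root`); `star` is a dart of the outer face whose tail is
-- the marked vertex ★ (it also records the outer corner at ★).

record CMap : Set where
  constructor cmap
  field
    edges : ℕ
    σ     : ℕ → ℕ
    root  : ℕ
    star  : ℕ
open CMap public

flip : ℕ → ℕ
flip zero          = 1
flip (suc zero)    = 0
flip (suc (suc d)) = suc (suc (flip d))

φ : CMap → ℕ → ℕ
φ M d = σ M (flip d)

iter : (ℕ → ℕ) → ℕ → ℕ → ℕ
iter f zero    x = x
iter f (suc k) x = f (iter f k x)

pre : (ℕ → ℕ) → ℕ → ℕ → ℕ
pre f s zero    = s
pre f s (suc k) = if f k ≡ᵇ s then k else pre f s k

update : (ℕ → ℕ) → ℕ → ℕ → ℕ → ℕ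
update f x v d = if d ≡ᵇ x then v else f d

-- single edge from R to ★
leafMap : CMap
leafMap = cmap 1 (λ d → d) 0 1

-- disjoint union of A and B, identifying ★ of A with R of B (B is placed
-- in the outer corner of ★_A, using its outer corner at R_B)
join : CMap → CMap → CMap
join A B = cmap (edges A + edges B) σ' (root A) (star B + o)
  where
  o = 2 * edges A
  base : ℕ → ℕ
  base d = if d <ᵇ o then σ A d else σ B (d ∸ o) + o
  x = pre (σ A) (star A) o
  y = pre (σ B) (root B) (2 * edges B) + o
  σ' = update (update base x (root B + o)) y (star A)

chain : CMap → List CMap → CMap
chain A []       = A
chain A (B ∷ Bs) = chain (join A B) Bs

-- add, in the outer face, a new edge from ★ to R; it becomes the root edge
close : CMap → CMap
close C = cmap (suc (edges C)) σ' c c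
  where
  c = 2 * edges C
  x = pre (σ C) (star C) c
  y = pre (σ C) (root C) c
  σ' = update (update (update (update (σ C) x c) c (star C)) y (suc c))
              (suc c) (root C)

-- mark as ★ the i-th vertex met counterclockwise around the outer face
-- starting from (not counting) R
mark : ℕ → CMap → CMap
mark i M = cmap (edges M) (σ M) (root M) (iter (φ M) i (root M))

mutual
  Mv : Tree → CMap
  Mv (node i [])       = leafMap
  Mv (node i (c ∷ cs)) = mark i (close (chain (Mv c) (Ms cs)))

  Ms : List Tree → List CMap
  Ms []       = []
  Ms (t ∷ ts) = Mv t ∷ Ms ts

-- the bijection Φ (no ★ is marked at the root of T)
Φ : Tree → CMap
Φ (node i [])       = leafMap
Φ (node i (c ∷ cs)) = close (chain (Mv c) (Ms cs))

anyBelow : (ℕ → Bool) → ℕ → Bool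
anyBelow p zero    = false
anyBelow p (suc k) = p k ∨ anyBelow p k

countBelow : (ℕ → Bool) → ℕ → ℕ
countBelow p zero    = 0
countBelow p (suc k) = (if p k then 1 else 0) + countBelow p k

inRootFace : CMap → ℕ → Bool
inRootFace M d = anyBelow (λ k → iter (φ M) k (root M) ≡ᵇ d) (2 * edges M)

onInternal2Face : CMap → ℕ → Bool
onInternal2Face M d =
  not (φ M d ≡ᵇ d) ∧ (φ M (φ M d) ≡ᵇ d) ∧ not (inRootFace M d)

-- number of internal 2-faces: each such face is counted via its unique
-- dart d with d < φ d
internal2Faces : CMap → ℕ
internal2Faces M =
  countBelow (λ d → onInternal2Face M d ∧ (d <ᵇ φ M d)) (2 * edges M)

Primitive : CMap → Set
Primitive M = ∀ d → d < 2 * edges M → onInternal2Face M d ≡ false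

module Submission where

-- Φ(T) is built by recursion on T from three operations on rotation
-- systems: `join` (glue two maps at a vertex), `close` (add the new root
-- edge in the outer face) and `mark` (move ★ along the outer face).  For
-- each intermediate map we track a splitting P ++ Q of its root face (the
-- φ-orbit of the root dart): P leads from R to ★, Q from ★ back to R
-- (the record `Marked`).
--
-- * `join` concatenates the root faces and keeps every other face, so
--   internal 2-faces add up (module `JoinMaps`).
-- * `close` splits the root face P ++ Q into the new root face (new dart
--   then P) and a new inner face (other new dart then Q) of degree 1 + |Q|,
--   keeping every other face; it creates an internal 2-face exactly when
--   |Q| = 1 (module `CloseMap`).
-- * `mark i` re-splits the root face after its i-th dart (`markSplit`).
--
-- After general facts on permutations of {0, …, n-1}, orbit segments,
-- lists and counting, these three steps are proved; then induction on the
-- tree gives |P| = label v, |Q| = 1 + (maxLabel v ∸ label v) for M(v)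
-- (`nodeShape`).  So |Q| = 1 before closing v iff v has a single child u
-- with label u = maxLabel u, whence internal2Faces (Φ T) = countOnlyMax T
-- (`Φ-faces`).

open import Defs
open import Data.Nat using (ℕ; zero; suc; _+_; _*_; _∸_; _≤_; _<_; _≡ᵇ_; _<ᵇ_; z≤n; s≤s; z<s; s<s; s≤s⁻¹)
open import Data.Nat.Properties
open import Data.Nat.Solver using (module +-*-Solver)
open import Data.Bool using (Bool; true; false; if_then_else_; _∧_; not)
open import Data.Bool.Properties using (∨-zeroʳ; ∧-zeroʳ; T-≡)
open import Data.List using (List; []; _∷_; _++_; map; length; take; drop)
open import Data.List.Properties using (++-conicalˡ; ++-conicalʳ; map-++; length-++; length-map; length-take; length-drop; take++drop≡id)
open import Data.List.Membership.Propositional using (_∈_; _∉_)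
open import Data.List.Membership.Propositional.Properties using (∈-++⁻; ∈-++⁺ˡ; ∈-++⁺ʳ; ∈-map⁺; ∈-map⁻)
open import Data.List.Membership.DecPropositional _≟_ using (_∈?_)
open import Data.List.Relation.Unary.Any using (Any; here; there)
open import Data.Product using (_×_; _,_; proj₁; proj₂; ∃-syntax)
open import Data.Sum using (_⊎_; inj₁; inj₂; [_,_]′)
open import Data.Empty using (⊥)
open import Function.Bundles using (Equivalence; mk⇔)
open import Relation.Nullary using (¬_; yes; no; contradiction)
open import Relation.Nullary.Decidable using (dec-true; dec-false; does-⇔)
open import Relation.Binary.PropositionalEquality

≡ᵇ-true⇒≡ : ∀ m n → (m ≡ᵇ n) ≡ true → m ≡ n
≡ᵇ-true⇒≡ m n e = ≡ᵇ⇒≡ m n (Equivalence.from T-≡ e)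

≡ᵇ-false⇒≢ : ∀ m n → (m ≡ᵇ n) ≡ false → m ≢ n
≡ᵇ-false⇒≢ m n e m≡n with trans (sym e) (dec-true (m ≟ n) m≡n)
... | ()

≡ᵇ-shift : ∀ o a b → (a + o ≡ᵇ b + o) ≡ (a ≡ᵇ b)
≡ᵇ-shift o a b = does-⇔ (mk⇔ (+-cancelʳ-≡ o a b) (cong (_+ o))) (a + o ≟ b + o) (a ≟ b)

<ᵇ-shift : ∀ o a b → (a + o <ᵇ b + o) ≡ (a <ᵇ b)
<ᵇ-shift o a b = does-⇔ (mk⇔ (+-cancelʳ-< o a b) (+-monoˡ-< o)) (a + o <? b + o) (a <? b)

if-true : ∀ {A : Set} {b : Bool} {x y : A} → b ≡ true → (if b then x else y) ≡ x
if-true refl = refl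

if-false : ∀ {A : Set} {b : Bool} {x y : A} → b ≡ false → (if b then x else y) ≡ y
if-false refl = refl

update-hit : ∀ f x v → update f x v x ≡ v
update-hit f x v = if-true (dec-true (x ≟ x) refl)

update-miss : ∀ f x v d → d ≢ x → update f x v d ≡ f d
update-miss f x v d d≢x = if-false (dec-false (d ≟ x) d≢x)

<2+⇒< : ∀ {d m} → d < suc (suc m) → d ≢ suc m → d ≢ m → d < m
<2+⇒< lt d≢m+1 d≢m with m≤n⇒m<n∨m≡n (s≤s⁻¹ lt)
... | inj₂ e = contradiction e d≢m+1
... | inj₁ lt' with m≤n⇒m<n∨m≡n (s≤s⁻¹ lt')
...   | inj₂ e = contradiction e d≢m
...   | inj₁ lt'' = lt''

flip-involutive : ∀ d → flip (flip d) ≡ d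
flip-involutive zero = refl
flip-involutive (suc zero) = refl
flip-involutive (suc (suc d)) = cong (λ t → suc (suc t)) (flip-involutive d)

flip-injective : ∀ a b → flip a ≡ flip b → a ≡ b
flip-injective a b e = trans (sym (flip-involutive a)) (trans (cong flip e) (flip-involutive b))

flip-bounded : ∀ e d → d < 2 * e → flip d < 2 * e
flip-bounded zero d ()
flip-bounded (suc e) d h =
  subst (flip d <_) (sym (*-suc 2 e)) (step d (subst (d <_) (*-suc 2 e) h))
  where
  step : ∀ d → d < 2 + 2 * e → flip d < 2 + 2 * e
  step zero _ = s<s z<s
  step (suc zero) _ = z<s
  step (suc (suc d)) (s<s (s<s d<2e)) = s<s (s<s (flip-bounded e d d<2e))

flip-shift : ∀ e m → flip (m + 2 * e) ≡ flip m + 2 * e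
flip-shift zero m rewrite +-identityʳ m | +-identityʳ (flip m) = refl
flip-shift (suc e) m rewrite *-suc 2 e | +-suc m (suc (2 * e)) | +-suc m (2 * e)
  | +-suc (flip m) (suc (2 * e)) | +-suc (flip m) (2 * e) = cong (λ t → suc (suc t)) (flip-shift e m)

flip-even : ∀ k → flip (2 * k) ≡ suc (2 * k)
flip-even zero = refl
flip-even (suc k) rewrite *-suc 2 k = cong (λ t → suc (suc t)) (flip-even k)

flip-odd : ∀ k → flip (suc (2 * k)) ≡ 2 * k
flip-odd k = trans (cong flip (sym (flip-even k))) (flip-involutive (2 * k))

MapsInto : (ℕ → ℕ) → ℕ → Set
MapsInto f n = ∀ d → d < n → f d < n

InjectiveOn : (ℕ → ℕ) → ℕ → Set
InjectiveOn f n = ∀ a b → a < n → b < n → f a ≡ f b → a ≡ b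

Bounded : ℕ → List ℕ → Set
Bounded n L = ∀ x → x ∈ L → x < n

pre-correct : ∀ f s n p → InjectiveOn f n → p < n → f p ≡ s → pre f s n ≡ p
pre-correct f s zero p inj () fp
pre-correct f s (suc k) p inj p<n fp with f k ≡ᵇ s in eq
... | true = inj k p (n<1+n k) p<n (trans (≡ᵇ-true⇒≡ (f k) s eq) (sym fp))
... | false = pre-correct f s k p inj' p<k fp
  where
  inj' : InjectiveOn f k
  inj' a b a<k b<k = inj a b (m<n⇒m<1+n a<k) (m<n⇒m<1+n b<k)
  p<k : p < k
  p<k with m≤n⇒m<n∨m≡n (s≤s⁻¹ p<n)
  ... | inj₁ lt = lt
  ... | inj₂ refl = contradiction fp (≡ᵇ-false⇒≢ (f p) s eq)

-- the transposition of a and b; redirecting two values of σ is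
-- precomposition with a transposition, which preserves injectivity
swap : ℕ → ℕ → ℕ → ℕ
swap a b d = if d ≡ᵇ a then b else (if d ≡ᵇ b then a else d)

swap-a : ∀ a b → swap a b a ≡ b
swap-a a b = if-true (dec-true (a ≟ a) refl)

swap-b : ∀ a b → b ≢ a → swap a b b ≡ a
swap-b a b b≢a = trans (if-false (dec-false (b ≟ a) b≢a)) (if-true (dec-true (b ≟ b) refl))

swap-other : ∀ a b d → d ≢ a → d ≢ b → swap a b d ≡ d
swap-other a b d d≢a d≢b = trans (if-false (dec-false (d ≟ a) d≢a)) (if-false (dec-false (d ≟ b) d≢b))

swap-involutive : ∀ a b d → swap a b (swap a b d) ≡ d
swap-involutive a b d with d ≟ a
... | yes refl with b ≟ d
...   | yes refl = trans (cong (swap d d) (swap-a d d)) (swap-a d d)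
...   | no b≢d = trans (cong (swap d b) (swap-a d b)) (swap-b d b b≢d)
swap-involutive a b d | no d≢a with d ≟ b
... | yes refl = trans (cong (swap a d) (swap-b a d d≢a)) (swap-a a d)
... | no d≢b = trans (cong (swap a b) (swap-other a b d d≢a d≢b)) (swap-other a b d d≢a d≢b)

swap-bounded : ∀ a b d N → a < N → b < N → d < N → swap a b d < N
swap-bounded a b d N a<N b<N d<N with d ≟ a
... | yes refl = subst (_< N) (sym (swap-a a b)) b<N
... | no d≢a with d ≟ b
...   | yes refl = subst (_< N) (sym (swap-b a b d≢a)) a<N
...   | no d≢b = subst (_< N) (sym (swap-other a b d d≢a d≢b)) d<N

injectiveOn-swap : ∀ f g a b N → InjectiveOn f N → a < N → b < N →
  (∀ d → d < N → g d ≡ f (swap a b d)) → InjectiveOn g N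
injectiveOn-swap f g a b N inj a<N b<N g≡ p q p<N q<N e =
  trans (sym (swap-involutive a b p)) (trans (cong (swap a b) swapped) (swap-involutive a b q))
  where
  swapped : swap a b p ≡ swap a b q
  swapped = inj _ _ (swap-bounded a b p N a<N b<N p<N) (swap-bounded a b q N a<N b<N q<N)
              (trans (sym (g≡ p p<N)) (trans e (g≡ q q<N)))

record IsRotation (M : CMap) : Set where
  field
    into : MapsInto (σ M) (2 * edges M)
    inj  : InjectiveOn (σ M) (2 * edges M)

φ-mapsInto : ∀ M → MapsInto (σ M) (2 * edges M) → MapsInto (φ M) (2 * edges M)
φ-mapsInto M h d lt = h (flip d) (flip-bounded (edges M) d lt)

φ-injectiveOn : ∀ M → InjectiveOn (σ M) (2 * edges M) → InjectiveOn (φ M) (2 * edges M)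
φ-injectiveOn M h a b a<n b<n e =
  flip-injective a b (h _ _ (flip-bounded (edges M) a a<n) (flip-bounded (edges M) b b<n) e)

iter-suc : ∀ f k a → iter f (suc k) a ≡ iter f k (f a)
iter-suc f zero a = refl
iter-suc f (suc k) a = cong f (iter-suc f k a)

data Seg (f : ℕ → ℕ) : ℕ → List ℕ → ℕ → Set where
  nil  : ∀ {a} → Seg f a [] a
  cons : ∀ {a l b} → Seg f (f a) l b → Seg f a (a ∷ l) b

Seg-++ : ∀ {f a L m M b} → Seg f a L m → Seg f m M b → Seg f a (L ++ M) b
Seg-++ nil s = s
Seg-++ (cons s) t = cons (Seg-++ s t)

Seg-head : ∀ {f a x l b} → Seg f a (x ∷ l) b → x ≡ a
Seg-head (cons s) = refl

Seg-start∈ : ∀ {f a L b} → Seg f a L b → L ≢ [] → a ∈ L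
Seg-start∈ nil L≢[] = contradiction refl L≢[]
Seg-start∈ (cons _) _ = here refl

record LastStep (f : ℕ → ℕ) (a : ℕ) (L : List ℕ) (b : ℕ) : Set where
  field
    init   : List ℕ
    last   : ℕ
    split  : L ≡ init ++ last ∷ []
    before : Seg f a init last
    step   : f last ≡ b

  last∈ : last ∈ L
  last∈ = subst (last ∈_) (sym split) (∈-++⁺ʳ init (here refl))

Seg-last : ∀ {f a L b} → Seg f a L b → L ≢ [] → LastStep f a L b
Seg-last nil L≢[] = contradiction refl L≢[]
Seg-last {a = a} (cons nil) _ = record { init = [] ; last = a ; split = refl ; before = nil ; step = refl }
Seg-last {a = a} (cons s@(cons _)) _ = record
  { init = a ∷ init ; last = last ; split = cong (a ∷_) split ; before = cons before ; step = step }
  where open LastStep (Seg-last s (λ ()))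

Seg-cong : ∀ {f g a L b} → Seg f a L b → (∀ x → x ∈ L → g x ≡ f x) → Seg g a L b
Seg-cong nil h = nil
Seg-cong {g = g} (cons s) h =
  cons (subst (λ t → Seg g t _ _) (sym (h _ (here refl))) (Seg-cong s (λ x m → h x (there m))))

Seg-shift : ∀ {f g a L b} o → Seg f a L b → (∀ x → x ∈ L → g (x + o) ≡ f x + o) →
  Seg g (a + o) (map (_+ o) L) (b + o)
Seg-shift o nil h = nil
Seg-shift {g = g} o (cons s) h =
  cons (subst (λ t → Seg g t _ _) (sym (h _ (here refl))) (Seg-shift o s (λ x m → h x (there m))))

Seg-split : ∀ {f a} L {M b} → Seg f a (L ++ M) b →
  Seg f a L (iter f (length L) a) × Seg f (iter f (length L) a) M b
Seg-split [] s = nil , s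
Seg-split {f} {a} (x ∷ L) (cons s) with Seg-split L s
... | s1 , s2 = cons (subst (Seg f (f a) L) (sym (iter-suc f (length L) a)) s1)
              , subst (λ t → Seg f t _ _) (sym (iter-suc f (length L) a)) s2

Seg-at : ∀ {f a L b x} → Seg f a L b → x ∈ L →
  ∃[ L1 ] ∃[ L2 ] ((L ≡ L1 ++ L2) × Seg f a L1 x × Seg f x L2 b)
Seg-at (cons s) (here refl) = [] , _ , refl , nil , cons s
Seg-at {a = a} (cons s) (there m) with Seg-at s m
... | L1 , L2 , eq , s1 , s2 = (a ∷ L1) , L2 , cong (a ∷_) eq , cons s1 , s2

Seg-index : ∀ {f a L b x} → Seg f a L b → x ∈ L → ∃[ i ] (i < length L × iter f i a ≡ x)
Seg-index (cons s) (here refl) = 0 , z<s , refl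
Seg-index {f} {a} (cons s) (there m) with Seg-index s m
... | i , lt , e = suc i , s<s lt , trans (iter-suc f i a) e

Seg-next : ∀ {f a L b x} → Seg f a L b → x ∈ L → f x ∈ L ⊎ f x ≡ b
Seg-next (cons nil) (here refl) = inj₂ refl
Seg-next (cons (cons s)) (here refl) = inj₁ (there (here refl))
Seg-next (cons s) (there m) with Seg-next s m
... | inj₁ m' = inj₁ (there m')
... | inj₂ e = inj₂ e

Seg-previous : ∀ {f a L b x} → Seg f a L b → x ∈ L → x ≡ a ⊎ ∃[ p ] (p ∈ L × f p ≡ x)
Seg-previous (cons s) (here refl) = inj₁ refl
Seg-previous {a = a} (cons s) (there m) with Seg-previous s m
... | inj₁ e = inj₂ (a , here refl , sym e)
... | inj₂ (p , pm , e) = inj₂ (p , there pm , e)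

Seg-backward : ∀ {f a L b N} (S : ℕ → Set) → Seg f a L b → Bounded N L →
  (∀ y → y < N → S (f y) → S y) → S b → S a
Seg-backward S nil _ _ Sb = Sb
Seg-backward {a = a} S (cons s) bnd closed Sb =
  closed a (bnd a (here refl)) (Seg-backward S s (λ y m → bnd y (there m)) closed Sb)

cycle-closed : ∀ {f r l} → Seg f r (r ∷ l) r → ∀ k → iter f k r ∈ (r ∷ l)
cycle-closed s zero = here refl
cycle-closed s (suc k) with Seg-next s (cycle-closed s k)
... | inj₁ m = m
... | inj₂ e = subst (_∈ _) (sym e) (here refl)

cycle-backClosed : ∀ {f r l n d} → Seg f r (r ∷ l) r → InjectiveOn f n →
  Bounded n (r ∷ l) → d < n → f d ∈ (r ∷ l) → d ∈ (r ∷ l)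
cycle-backClosed s inj bnd d<n m with Seg-previous s m
... | inj₂ (p , pm , e) = subst (_∈ _) (inj p _ (bnd p pm) d<n e) pm
... | inj₁ e = subst (_∈ _) (inj last _ (bnd last last∈) d<n (trans step (sym e))) last∈
  where open LastStep (Seg-last s (λ ()))

singleton : ∀ (L : List ℕ) → length L ≡ 1 → ∃[ x ] L ≡ x ∷ []
singleton (x ∷ []) _ = x , refl

data Distinct : List ℕ → Set where
  done  : Distinct []
  fresh : ∀ {x l} → x ∉ l → Distinct l → Distinct (x ∷ l)

Disjoint : List ℕ → List ℕ → Set
Disjoint L M = ∀ x → x ∈ L → x ∈ M → ⊥

distinct-++⁻ : ∀ L {M} → Distinct (L ++ M) → Distinct L × Distinct M × Disjoint L M
distinct-++⁻ [] u = done , u , (λ x ())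
distinct-++⁻ (x ∷ L) (fresh x∉ u) with distinct-++⁻ L u
... | uL , uM , disj = fresh (λ m → x∉ (∈-++⁺ˡ m)) uL , uM , disj'
  where
  disj' : Disjoint (x ∷ L) _
  disj' y (here refl) m = x∉ (∈-++⁺ʳ L m)
  disj' y (there k) m = disj y k m

distinct-++⁺ : ∀ L {M} → Distinct L → Distinct M → Disjoint L M → Distinct (L ++ M)
distinct-++⁺ [] _ uM _ = uM
distinct-++⁺ (x ∷ L) (fresh x∉L uL) uM disj = fresh x∉ (distinct-++⁺ L uL uM (λ y a b → disj y (there a) b))
  where
  x∉ : x ∉ L ++ _
  x∉ m with ∈-++⁻ L m
  ... | inj₁ a = x∉L a
  ... | inj₂ b = disj x (here refl) b

∈-shift⁻ : ∀ o {m} L → m + o ∈ map (_+ o) L → m ∈ L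
∈-shift⁻ o {m} L h with ∈-map⁻ (_+ o) h
... | y , ym , e = subst (_∈ L) (sym (+-cancelʳ-≡ o m y e)) ym

distinct-shift : ∀ o L → Distinct L → Distinct (map (_+ o) L)
distinct-shift o [] done = done
distinct-shift o (x ∷ L) (fresh x∉ u) = fresh (λ m → x∉ (∈-shift⁻ o L m)) (distinct-shift o L u)

shift-≥ : ∀ o L x → x ∈ map (_+ o) L → o ≤ x
shift-≥ o L x h with ∈-map⁻ (_+ o) h
... | y , _ , refl = m≤n+m o y

shift-bounded : ∀ o n L → Bounded n L → Bounded (n + o) (map (_+ o) L)
shift-bounded o n L b x h with ∈-map⁻ (_+ o) h
... | y , ym , refl = +-monoˡ-< o (b y ym)

longCycle⇒no2Cycle : ∀ {f a l N x} → Seg f a (a ∷ l) a → Distinct (a ∷ l) → 2 ≤ length l →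
  MapsInto f N → InjectiveOn f N → Bounded N (a ∷ l) → x ∈ (a ∷ l) → f (f x) ≢ x
longCycle⇒no2Cycle {l = []} _ _ ()
longCycle⇒no2Cycle {l = _ ∷ []} _ _ (s≤s ())
longCycle⇒no2Cycle {f} {a} {b1 ∷ b2 ∷ _} {N} {x} s@(cons (cons (cons _))) (fresh a∉ _) _ into inj bnd x∈ ffx≡x =
  a∉ (there (here (sym ffa≡a)))
  where
  -- the 2-cycle {x, f x} is closed under preimages, so it contains a
  S : ℕ → Set
  S y = y ≡ x ⊎ y ≡ f x
  x<N : x < N
  x<N = bnd x x∈
  closed : ∀ y → y < N → S (f y) → S y
  closed y y<N (inj₁ e) = inj₂ (inj y (f x) y<N (into x x<N) (trans e (sym ffx≡x)))
  closed y y<N (inj₂ e) = inj₁ (inj y x y<N x<N e)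
  Sa : S a
  Sa with Seg-at s x∈
  ... | L1 , L2 , eq , s1 , _ =
    Seg-backward S s1 (λ y m → bnd y (subst (y ∈_) (sym eq) (∈-++⁺ˡ m))) closed (inj₁ refl)
  ffa≡a : f (f a) ≡ a
  ffa≡a with Sa
  ... | inj₁ refl = ffx≡x
  ... | inj₂ refl = cong f ffx≡x

anyBelow-true : ∀ p n k → k < n → p k ≡ true → anyBelow p n ≡ true
anyBelow-true p (suc n) k k<n pk with m≤n⇒m<n∨m≡n (s≤s⁻¹ k<n)
... | inj₂ refl rewrite pk = refl
... | inj₁ lt rewrite anyBelow-true p n k lt pk = ∨-zeroʳ (p n)

anyBelow-false : ∀ p n → (∀ k → k < n → p k ≡ false) → anyBelow p n ≡ false
anyBelow-false p zero h = refl
anyBelow-false p (suc n) h rewrite h n (n<1+n n) = anyBelow-false p n (λ k lt → h k (m<n⇒m<1+n lt))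

countBelow-cong : ∀ p q n → (∀ k → k < n → p k ≡ q k) → countBelow p n ≡ countBelow q n
countBelow-cong p q zero h = refl
countBelow-cong p q (suc n) h rewrite h n (n<1+n n) =
  cong (_ +_) (countBelow-cong p q n (λ k lt → h k (m<n⇒m<1+n lt)))

countBelow-split : ∀ p a b → countBelow p (b + a) ≡ countBelow (λ k → p (k + a)) b + countBelow p a
countBelow-split p a zero = refl
countBelow-split p a (suc b) rewrite countBelow-split p a b =
  sym (+-assoc (if p (b + a) then 1 else 0) _ _)

countBelow-zero : ∀ p n → (∀ k → k < n → p k ≡ false) → countBelow p n ≡ 0
countBelow-zero p zero h = refl
countBelow-zero p (suc n) h rewrite h n (n<1+n n) = countBelow-zero p n (λ k lt → h k (m<n⇒m<1+n lt))

countBelow-zero⁻ : ∀ p n → countBelow p n ≡ 0 → ∀ k → k < n → p k ≡ false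
countBelow-zero⁻ p (suc n) e k k<n with p n in pn
countBelow-zero⁻ p (suc n) () k k<n | true
... | false with m≤n⇒m<n∨m≡n (s≤s⁻¹ k<n)
...   | inj₂ refl = pn
...   | inj₁ lt = countBelow-zero⁻ p n e k lt

countBelow-one : ∀ p q n s → s < n → p s ≡ true → q s ≡ false →
  (∀ k → k < n → k ≢ s → p k ≡ q k) → countBelow p n ≡ 1 + countBelow q n
countBelow-one p q (suc n) s s<n ps qs h with m≤n⇒m<n∨m≡n (s≤s⁻¹ s<n)
... | inj₂ refl rewrite ps | qs = cong suc (countBelow-cong p q n (λ k lt → h k (m<n⇒m<1+n lt) (<⇒≢ lt)))
... | inj₁ lt rewrite h n (n<1+n n) (λ e → <⇒≢ lt (sym e))
                    | countBelow-one p q n s lt ps qs (λ k lt' → h k (m<n⇒m<1+n lt')) =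
  +-suc (if q n then 1 else 0) (countBelow q n)

counted : CMap → ℕ → Bool
counted M d = onInternal2Face M d ∧ (d <ᵇ φ M d)

-- `counted M d` is `faceTest` applied to the four observations
-- "φ d = d", "φ (φ d) = d", "d on the root face", "d < φ d"
faceTest : Bool → Bool → Bool → Bool → Bool
faceTest fixed twoCycle onRoot below = (not fixed ∧ twoCycle ∧ not onRoot) ∧ below

faceTest-cong : ∀ {a a' b b' r r' l l'} → a ≡ a' → b ≡ b' → r ≡ r' → l ≡ l' →
  faceTest a b r l ≡ faceTest a' b' r' l'
faceTest-cong refl refl refl refl = refl

faceTest-onRoot : ∀ a b l → faceTest a b true l ≡ false
faceTest-onRoot true b l = refl
faceTest-onRoot false true l = refl
faceTest-onRoot false false l = refl

faceTest-notTwoCycle : ∀ a r l → faceTest a false r l ≡ false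
faceTest-notTwoCycle true r l = refl
faceTest-notTwoCycle false r l = refl

record RootFace (M : CMap) (L : List ℕ) : Set where
  field
    rotation : IsRotation M
    rest     : List ℕ
    listed   : L ≡ root M ∷ rest
    orbit    : Seg (φ M) (root M) (root M ∷ rest) (root M)
    bounded  : Bounded (2 * edges M) L
    distinct : Distinct L
    short    : length L ≤ 2 * edges M

module _ {M : CMap} {L : List ℕ} (R : RootFace M L) where
  open RootFace R

  rootFace-in : ∀ {d} → d ∈ L → inRootFace M d ≡ true
  rootFace-in {d} d∈ with Seg-index orbit (subst (d ∈_) listed d∈)
  ... | i , i<len , e = anyBelow-true _ (2 * edges M) i
          (≤-trans i<len (subst (λ t → length t ≤ 2 * edges M) listed short)) (dec-true (_ ≟ d) e)

  rootFace-out : ∀ {d} → d ∉ L → inRootFace M d ≡ false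
  rootFace-out {d} d∉ = anyBelow-false _ (2 * edges M)
    (λ k _ → dec-false (iter (φ M) k (root M) ≟ d) (λ e → d∉ (subst (_∈ L) e (onFace k))))
    where
    onFace : ∀ k → iter (φ M) k (root M) ∈ L
    onFace k = subst (_ ∈_) (sym listed) (cycle-closed orbit k)

  rootFace-backClosed : ∀ {d} → d < 2 * edges M → φ M d ∈ L → d ∈ L
  rootFace-backClosed {d} d<n m = subst (d ∈_) (sym listed)
    (cycle-backClosed orbit (φ-injectiveOn M (IsRotation.inj rotation))
      (subst (Bounded (2 * edges M)) listed bounded) d<n (subst (φ M d ∈_) listed m))

  rootFace-next : ∀ {d} → d ∈ L → φ M d ∈ L
  rootFace-next {d} d∈ with Seg-next orbit (subst (d ∈_) listed d∈)
  ... | inj₁ m = subst (φ M d ∈_) (sym listed) m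
  ... | inj₂ e = subst (φ M d ∈_) (sym listed) (subst (_∈ _) (sym e) (here refl))

  rootFace-notCounted : ∀ {d} → d ∈ L → counted M d ≡ false
  rootFace-notCounted {d} d∈ =
    trans (faceTest-cong {a = fixed} {b = twoCycle} {l = below} refl refl (rootFace-in d∈) refl)
          (faceTest-onRoot fixed twoCycle below)
    where
    fixed twoCycle below : Bool
    fixed = φ M d ≡ᵇ d
    twoCycle = φ M (φ M d) ≡ᵇ d
    below = d <ᵇ φ M d

record Marked (M : CMap) (P Q : List ℕ) : Set where
  field
    rotation : IsRotation M
    fromRoot : Seg (φ M) (root M) P (star M)
    toRoot   : Seg (φ M) (star M) Q (root M)
    P≢[]     : P ≢ []
    Q≢[]     : Q ≢ []
    bounded  : Bounded (2 * edges M) (P ++ Q)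
    distinct : Distinct (P ++ Q)
    short    : length P + length Q ≤ 2 * edges M

markedRootFace : ∀ {M P Q} → Marked M P Q → RootFace M (P ++ Q)
markedRootFace {M} {[]} I = contradiction refl (Marked.P≢[] I)
markedRootFace {M} {p ∷ P} {Q} I with Marked.fromRoot I
... | cons s = record
  { rotation = Marked.rotation I ; rest = P ++ Q ; listed = refl
  ; orbit = Seg-++ (cons s) (Marked.toRoot I)
  ; bounded = Marked.bounded I ; distinct = Marked.distinct I
  ; short = subst (_≤ 2 * edges M) (sym (length-++ (p ∷ P))) (Marked.short I) }

-- The darts of B are shifted by o = 2·edges A;
-- the σ of the join is the disjoint union of σ_A and σ_B with two values
-- redirected so that the root faces are spliced at ★_A = R_B.  The new
-- root face is P_A ++ P_B ++ Q_B ++ Q_A and every other face of A or B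
-- survives unchanged.

module JoinMaps (A B : CMap) {PA QA PB QB : List ℕ} (IA : Marked A PA QA) (IB : Marked B PB QB) where
  o : ℕ
  o = 2 * edges A
  nB : ℕ
  nB = 2 * edges B
  JM : CMap
  JM = join A B
  N : ℕ
  N = nB + o

  darts-join : 2 * edges JM ≡ N
  darts-join = trans (*-distribˡ-+ 2 (edges A) (edges B)) (+-comm o nB)

  injA : InjectiveOn (σ A) o
  injA = IsRotation.inj (Marked.rotation IA)
  injB : InjectiveOn (σ B) nB
  injB = IsRotation.inj (Marked.rotation IB)
  intoA : MapsInto (σ A) o
  intoA = IsRotation.into (Marked.rotation IA)
  intoB : MapsInto (σ B) nB
  intoB = IsRotation.into (Marked.rotation IB)

  -- zA is the last dart of P_A (φ zA = ★_A), wB the last dart of Q_B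
  -- (φ wB = R_B); the join redirects exactly these two darts
  lastA : LastStep (φ A) (root A) PA (star A)
  lastA = Seg-last (Marked.fromRoot IA) (Marked.P≢[] IA)
  open LastStep lastA using () renaming (init to PA0; last to zA; split to PA-split; before to segPA0; step to φzA; last∈ to zA∈PA)

  lastB : LastStep (φ B) (star B) QB (root B)
  lastB = Seg-last (Marked.toRoot IB) (Marked.Q≢[] IB)
  open LastStep lastB using () renaming (init to QB0; last to wB; split to QB-split; before to segQB0; step to φwB; last∈ to wB∈QB)

  distinctA : Distinct PA × Distinct QA × Disjoint PA QA
  distinctA = distinct-++⁻ PA (Marked.distinct IA)
  distinctB : Distinct PB × Distinct QB × Disjoint PB QB
  distinctB = distinct-++⁻ PB (Marked.distinct IB)
  disjA : Disjoint PA QA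
  disjA = proj₂ (proj₂ distinctA)
  disjB : Disjoint PB QB
  disjB = proj₂ (proj₂ distinctB)

  boundedA : Bounded o (PA ++ QA)
  boundedA = Marked.bounded IA
  boundedB : Bounded nB (PB ++ QB)
  boundedB = Marked.bounded IB

  zA<o : zA < o
  zA<o = boundedA zA (∈-++⁺ˡ zA∈PA)
  wB<nB : wB < nB
  wB<nB = boundedB wB (∈-++⁺ʳ PB wB∈QB)

  PA0-≢zA : ∀ x → x ∈ PA0 → x ≢ zA
  PA0-≢zA x m refl =
    proj₂ (proj₂ (distinct-++⁻ PA0 (subst Distinct PA-split (proj₁ distinctA)))) x m (here refl)
  QB0-≢wB : ∀ x → x ∈ QB0 → x ≢ wB
  QB0-≢wB x m refl =
    proj₂ (proj₂ (distinct-++⁻ QB0 (subst Distinct QB-split (proj₁ (proj₂ distinctB))))) x m (here refl)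

  -- X = flip zA and Y = flip wB + o are the darts whose σ-values change
  X : ℕ
  X = pre (σ A) (star A) o
  X≡ : X ≡ flip zA
  X≡ = pre-correct (σ A) (star A) o (flip zA) injA (flip-bounded (edges A) zA zA<o) φzA
  Y : ℕ
  Y = pre (σ B) (root B) nB + o
  Y≡ : Y ≡ flip wB + o
  Y≡ = cong (_+ o) (pre-correct (σ B) (root B) nB (flip wB) injB (flip-bounded (edges B) wB wB<nB) φwB)

  X<o : X < o
  X<o = subst (_< o) (sym X≡) (flip-bounded (edges A) zA zA<o)
  o≤Y : o ≤ Y
  o≤Y = m≤n+m o (pre (σ B) (root B) nB)
  X≢Y : X ≢ Y
  X≢Y e = <⇒≱ X<o (subst (o ≤_) (sym e) o≤Y)
  o≤N : o ≤ N
  o≤N = m≤n+m o nB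
  X<N : X < N
  X<N = <-≤-trans X<o o≤N
  Y<N : Y < N
  Y<N = subst (_< N) (sym Y≡) (+-monoˡ-< o (flip-bounded (edges B) wB wB<nB))

  union : ℕ → ℕ
  union d = if d <ᵇ o then σ A d else σ B (d ∸ o) + o

  union-A : ∀ d → d < o → union d ≡ σ A d
  union-A d d<o = if-true (dec-true (d <? o) d<o)
  union-B : ∀ m → union (m + o) ≡ σ B m + o
  union-B m = trans (if-false (dec-false (m + o <? o) (λ lt → <⇒≱ lt (m≤n+m o m))))
                    (cong (λ t → σ B t + o) (m+n∸n≡m m o))

  σJ-X : σ JM X ≡ root B + o
  σJ-X = trans (update-miss (update union X (root B + o)) Y (star A) X X≢Y) (update-hit union X (root B + o))
  σJ-Y : σ JM Y ≡ star A
  σJ-Y = update-hit (update union X (root B + o)) Y (star A)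
  σJ-other : ∀ d → d ≢ X → d ≢ Y → σ JM d ≡ union d
  σJ-other d d≢X d≢Y =
    trans (update-miss (update union X (root B + o)) Y (star A) d d≢Y) (update-miss union X (root B + o) d d≢X)

  σJ-swap : ∀ d → σ JM d ≡ union (swap X Y d)
  σJ-swap d with d ≟ X
  ... | yes refl = trans σJ-X (trans (sym union-Y) (cong union (sym (swap-a X Y))))
    where
    union-Y : union Y ≡ root B + o
    union-Y = trans (cong union Y≡) (trans (union-B (flip wB)) (cong (_+ o) φwB))
  ... | no d≢X with d ≟ Y
  ...   | yes refl = trans σJ-Y (trans (sym union-X) (cong union (sym (swap-b X Y d≢X))))
    where
    union-X : union X ≡ star A
    union-X = trans (union-A X X<o) (trans (cong (σ A) X≡) φzA)
  ...   | no d≢Y = trans (σJ-other d d≢X d≢Y) (cong union (sym (swap-other X Y d d≢X d≢Y)))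

  data JoinDart (d : ℕ) : Set where
    fromA : d < o → JoinDart d
    fromB : ∀ m → m < nB → d ≡ m + o → JoinDart d

  joinDart : ∀ d → d < N → JoinDart d
  joinDart d d<N with d <? o
  ... | yes d<o = fromA d<o
  ... | no d≮o = fromB (d ∸ o) (+-cancelʳ-< o (d ∸ o) nB (subst (_< N) (sym e) d<N)) (sym e)
    where
    e : d ∸ o + o ≡ d
    e = m∸n+n≡m (≮⇒≥ d≮o)

  union-into : MapsInto union N
  union-into d d<N with joinDart d d<N
  ... | fromA d<o = subst (_< N) (sym (union-A d d<o)) (<-≤-trans (intoA d d<o) o≤N)
  ... | fromB m m<nB refl = subst (_< N) (sym (union-B m)) (+-monoˡ-< o (intoB m m<nB))

  union-inj : InjectiveOn union N
  union-inj a b a<N b<N e with joinDart a a<N | joinDart b b<N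
  ... | fromA a<o | fromA b<o = injA a b a<o b<o (trans (sym (union-A a a<o)) (trans e (union-A b b<o)))
  ... | fromA a<o | fromB m _ refl =
    contradiction (m≤n+m o (σ B m)) (<⇒≱ (subst (_< o) (trans (sym (union-A a a<o)) (trans e (union-B m))) (intoA a a<o)))
  ... | fromB m _ refl | fromA b<o =
    contradiction (m≤n+m o (σ B m)) (<⇒≱ (subst (_< o) (trans (sym (union-A b b<o)) (trans (sym e) (union-B m))) (intoA b b<o)))
  ... | fromB m m<nB refl | fromB m' m'<nB refl =
    cong (_+ o) (injB m m' m<nB m'<nB (+-cancelʳ-≡ o _ _ (trans (sym (union-B m)) (trans e (union-B m')))))

  rotation : IsRotation JM
  rotation = record
    { into = λ d lt → subst (σ JM d <_) (sym darts-join)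
        (subst (_< N) (sym (σJ-swap d)) (union-into _ (swap-bounded X Y d N X<N Y<N (subst (d <_) darts-join lt))))
    ; inj = subst (InjectiveOn (σ JM)) (sym darts-join)
        (injectiveOn-swap union (σ JM) X Y N union-inj X<N Y<N (λ d _ → σJ-swap d)) }

  φJ-zA : φ JM zA ≡ root B + o
  φJ-zA = trans (cong (σ JM) (sym X≡)) σJ-X

  φJ-A : ∀ d → d < o → d ≢ zA → φ JM d ≡ φ A d
  φJ-A d d<o d≢zA = trans (σJ-other (flip d) fd≢X fd≢Y) (union-A (flip d) fd<o)
    where
    fd<o : flip d < o
    fd<o = flip-bounded (edges A) d d<o
    fd≢X : flip d ≢ X
    fd≢X e = d≢zA (flip-injective d zA (trans e X≡))
    fd≢Y : flip d ≢ Y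
    fd≢Y e = <⇒≱ fd<o (subst (o ≤_) (sym e) o≤Y)

  φJ-wB : φ JM (wB + o) ≡ star A
  φJ-wB = trans (cong (σ JM) (trans (flip-shift (edges A) wB) (sym Y≡))) σJ-Y

  φJ-B : ∀ m → m ≢ wB → φ JM (m + o) ≡ φ B m + o
  φJ-B m m≢wB =
    trans (cong (σ JM) (flip-shift (edges A) m)) (trans (σJ-other (flip m + o) fm≢X fm≢Y) (union-B (flip m)))
    where
    fm≢X : flip m + o ≢ X
    fm≢X e = <⇒≱ X<o (subst (o ≤_) e (m≤n+m o (flip m)))
    fm≢Y : flip m + o ≢ Y
    fm≢Y e = m≢wB (flip-injective m wB (+-cancelʳ-≡ o _ _ (trans e Y≡)))

  PB' QB' PJ QJ : List ℕ
  PB' = map (_+ o) PB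
  QB' = map (_+ o) QB
  PJ = PA ++ PB'
  QJ = QB' ++ QA

  fromRootJ : Seg (φ JM) (root A) PJ (star B + o)
  fromRootJ = subst (λ L → Seg (φ JM) (root A) (L ++ PB') (star B + o)) (sym PA-split)
                (Seg-++ (Seg-++ throughA stepA) throughB)
    where
    throughA : Seg (φ JM) (root A) PA0 zA
    throughA = Seg-cong segPA0 (λ x m → φJ-A x (boundedA x (∈-++⁺ˡ (subst (x ∈_) (sym PA-split) (∈-++⁺ˡ m))))
                                                (PA0-≢zA x m))
    stepA : Seg (φ JM) zA (zA ∷ []) (root B + o)
    stepA = cons (subst (λ t → Seg (φ JM) t [] (root B + o)) (sym φJ-zA) nil)
    throughB : Seg (φ JM) (root B + o) PB' (star B + o)
    throughB = Seg-shift o (Marked.fromRoot IB)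
                 (λ m m∈ → φJ-B m (λ e → disjB m m∈ (subst (_∈ QB) (sym e) wB∈QB)))

  toRootJ : Seg (φ JM) (star B + o) QJ (root A)
  toRootJ = subst (λ L → Seg (φ JM) (star B + o) (L ++ QA) (root A)) (sym QB'-split)
              (Seg-++ (Seg-++ throughB stepB) throughA)
    where
    QB'-split : QB' ≡ map (_+ o) QB0 ++ (wB + o) ∷ []
    QB'-split = trans (cong (map (_+ o)) QB-split) (map-++ (_+ o) QB0 (wB ∷ []))
    throughB : Seg (φ JM) (star B + o) (map (_+ o) QB0) (wB + o)
    throughB = Seg-shift o segQB0 (λ m m∈ → φJ-B m (QB0-≢wB m m∈))
    stepB : Seg (φ JM) (wB + o) ((wB + o) ∷ []) (star A)
    stepB = cons (subst (λ t → Seg (φ JM) t [] (star A)) (sym φJ-wB) nil)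
    throughA : Seg (φ JM) (star A) QA (root A)
    throughA = Seg-cong (Marked.toRoot IA)
                 (λ x m → φJ-A x (boundedA x (∈-++⁺ʳ PA m)) (λ e → disjA zA zA∈PA (subst (_∈ QA) e m)))

  A-not-shifted : ∀ x → x ∈ PA ++ QA → ¬ (o ≤ x)
  A-not-shifted x m = <⇒≱ (boundedA x m)

  boundedJ : Bounded N (PJ ++ QJ)
  boundedJ x m with ∈-++⁻ PJ m
  ... | inj₁ m1 with ∈-++⁻ PA m1
  ...   | inj₁ a = <-≤-trans (boundedA x (∈-++⁺ˡ a)) o≤N
  ...   | inj₂ b = shift-bounded o nB PB (λ y k → boundedB y (∈-++⁺ˡ k)) x b
  boundedJ x m | inj₂ m2 with ∈-++⁻ QB' m2
  ...   | inj₁ a = shift-bounded o nB QB (λ y k → boundedB y (∈-++⁺ʳ PB k)) x a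
  ...   | inj₂ b = <-≤-trans (boundedA x (∈-++⁺ʳ PA b)) o≤N

  distinctJ : Distinct (PJ ++ QJ)
  distinctJ = distinct-++⁺ PJ
    (distinct-++⁺ PA (proj₁ distinctA) (distinct-shift o PB (proj₁ distinctB)) PA#PB')
    (distinct-++⁺ QB' (distinct-shift o QB (proj₁ (proj₂ distinctB))) (proj₁ (proj₂ distinctA)) QB'#QA)
    PJ#QJ
    where
    PA#PB' : Disjoint PA PB'
    PA#PB' x a b = A-not-shifted x (∈-++⁺ˡ a) (shift-≥ o PB x b)
    QB'#QA : Disjoint QB' QA
    QB'#QA x a b = A-not-shifted x (∈-++⁺ʳ PA b) (shift-≥ o QB x a)
    PJ#QJ : Disjoint PJ QJ
    PJ#QJ x a b with ∈-++⁻ PA a | ∈-++⁻ QB' b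
    ... | inj₁ a1 | inj₁ b1 = A-not-shifted x (∈-++⁺ˡ a1) (shift-≥ o QB x b1)
    ... | inj₁ a1 | inj₂ b2 = disjA x a1 b2
    ... | inj₂ a2 | inj₂ b2 = A-not-shifted x (∈-++⁺ʳ PA b2) (shift-≥ o PB x a2)
    ... | inj₂ a2 | inj₁ b1 with ∈-map⁻ (_+ o) a2
    ...   | y , y∈ , refl = disjB y y∈ (∈-shift⁻ o QB b1)

  shortJ : length PJ + length QJ ≤ N
  shortJ rewrite length-++ PA {PB'} | length-++ QB' {QA} | length-map (_+ o) PB | length-map (_+ o) QB =
    subst (_≤ N) (rearrange (length PA) (length PB) (length QB) (length QA))
      (+-mono-≤ (Marked.short IB) (Marked.short IA))
    where
    open +-*-Solver
    rearrange : ∀ a b c d → (b + c) + (a + d) ≡ (a + b) + (c + d)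
    rearrange = solve 4 (λ a b c d → (b :+ c) :+ (a :+ d) := (a :+ b) :+ (c :+ d)) refl

  P≢[]J : PJ ≢ []
  P≢[]J e = Marked.P≢[] IA (++-conicalˡ PA PB' e)

  Q≢[]J : QJ ≢ []
  Q≢[]J e = Marked.Q≢[] IA (++-conicalʳ QB' QA e)

  marked : Marked JM PJ QJ
  marked = record
    { rotation = rotation ; fromRoot = fromRootJ ; toRoot = toRootJ
    ; P≢[] = P≢[]J ; Q≢[] = Q≢[]J
    ; bounded = subst (λ n → Bounded n (PJ ++ QJ)) (sym darts-join) boundedJ
    ; distinct = distinctJ
    ; short = subst (length PJ + length QJ ≤_) (sym darts-join) shortJ }

  faceA : RootFace A (PA ++ QA)
  faceA = markedRootFace IA
  faceB : RootFace B (PB ++ QB)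
  faceB = markedRootFace IB
  faceJ : RootFace JM (PJ ++ QJ)
  faceJ = markedRootFace marked

  ∈J-fromA : ∀ {x} → x ∈ PA ++ QA → x ∈ PJ ++ QJ
  ∈J-fromA m with ∈-++⁻ PA m
  ... | inj₁ a = ∈-++⁺ˡ (∈-++⁺ˡ a)
  ... | inj₂ b = ∈-++⁺ʳ PJ (∈-++⁺ʳ QB' b)

  ∈J-fromB : ∀ {m} → m ∈ PB ++ QB → m + o ∈ PJ ++ QJ
  ∈J-fromB k with ∈-++⁻ PB k
  ... | inj₁ a = ∈-++⁺ˡ (∈-++⁺ʳ PA (∈-map⁺ (_+ o) a))
  ... | inj₂ b = ∈-++⁺ʳ PJ (∈-++⁺ˡ (∈-map⁺ (_+ o) b))

  ∈J⇒∈A : ∀ {x} → x < o → x ∈ PJ ++ QJ → x ∈ PA ++ QA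
  ∈J⇒∈A {x} x<o m with ∈-++⁻ PJ m
  ... | inj₁ m1 with ∈-++⁻ PA m1
  ...   | inj₁ a = ∈-++⁺ˡ a
  ...   | inj₂ b = contradiction (shift-≥ o PB x b) (<⇒≱ x<o)
  ∈J⇒∈A {x} x<o m | inj₂ m2 with ∈-++⁻ QB' m2
  ...   | inj₁ a = contradiction (shift-≥ o QB x a) (<⇒≱ x<o)
  ...   | inj₂ b = ∈-++⁺ʳ PA b

  ∈J⇒∈B : ∀ {m} → m + o ∈ PJ ++ QJ → m ∈ PB ++ QB
  ∈J⇒∈B {m} k with ∈-++⁻ PJ k
  ... | inj₁ m1 with ∈-++⁻ PA m1
  ...   | inj₁ a = contradiction (m≤n+m o m) (A-not-shifted _ (∈-++⁺ˡ a))
  ...   | inj₂ b = ∈-++⁺ˡ (∈-shift⁻ o PB b)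
  ∈J⇒∈B {m} k | inj₂ m2 with ∈-++⁻ QB' m2
  ...   | inj₁ a = ∈-++⁺ʳ PB (∈-shift⁻ o QB a)
  ...   | inj₂ b = contradiction (m≤n+m o m) (A-not-shifted _ (∈-++⁺ʳ PA b))

  countedJ-A : ∀ d → d < o → counted JM d ≡ counted A d
  countedJ-A d d<o with d ∈? (PA ++ QA)
  ... | yes d∈ = trans (rootFace-notCounted faceJ (∈J-fromA d∈)) (sym (rootFace-notCounted faceA d∈))
  ... | no d∉ = faceTest-cong (cong (_≡ᵇ d) φd) (cong (_≡ᵇ d) φφd)
                  (trans (rootFace-out faceJ (λ m → d∉ (∈J⇒∈A d<o m))) (sym (rootFace-out faceA d∉)))
                  (cong (d <ᵇ_) φd)
    where
    zA∈ : zA ∈ PA ++ QA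
    zA∈ = ∈-++⁺ˡ zA∈PA
    φd : φ JM d ≡ φ A d
    φd = φJ-A d d<o (λ e → d∉ (subst (_∈ _) (sym e) zA∈))
    φd∉ : φ A d ∉ PA ++ QA
    φd∉ m = d∉ (rootFace-backClosed faceA d<o m)
    φφd : φ JM (φ JM d) ≡ φ A (φ A d)
    φφd = trans (cong (φ JM) φd)
                (φJ-A (φ A d) (φ-mapsInto A intoA d d<o) (λ e → φd∉ (subst (_∈ _) (sym e) zA∈)))

  countedJ-B : ∀ m → m < nB → counted JM (m + o) ≡ counted B m
  countedJ-B m m<nB with m ∈? (PB ++ QB)
  ... | yes m∈ = trans (rootFace-notCounted faceJ (∈J-fromB m∈)) (sym (rootFace-notCounted faceB m∈))
  ... | no m∉ = faceTest-cong (trans (cong (_≡ᵇ m + o) φm) (≡ᵇ-shift o (φ B m) m))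
                  (trans (cong (_≡ᵇ m + o) φφm) (≡ᵇ-shift o (φ B (φ B m)) m))
                  (trans (rootFace-out faceJ (λ k → m∉ (∈J⇒∈B k))) (sym (rootFace-out faceB m∉)))
                  (trans (cong (m + o <ᵇ_) φm) (<ᵇ-shift o m (φ B m)))
    where
    wB∈ : wB ∈ PB ++ QB
    wB∈ = ∈-++⁺ʳ PB wB∈QB
    φm : φ JM (m + o) ≡ φ B m + o
    φm = φJ-B m (λ e → m∉ (subst (_∈ _) (sym e) wB∈))
    φm∉ : φ B m ∉ PB ++ QB
    φm∉ k = m∉ (rootFace-backClosed faceB m<nB k)
    φφm : φ JM (φ JM (m + o)) ≡ φ B (φ B m) + o
    φφm = trans (cong (φ JM) φm) (φJ-B (φ B m) (λ e → φm∉ (subst (_∈ _) (sym e) wB∈)))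

  -- darts of A are counted as in A and shifted darts of B as in B
  internal2Faces-join : internal2Faces JM ≡ internal2Faces A + internal2Faces B
  internal2Faces-join = begin
      countBelow (counted JM) (2 * edges JM)
    ≡⟨ cong (countBelow (counted JM)) darts-join ⟩
      countBelow (counted JM) (nB + o)
    ≡⟨ countBelow-split (counted JM) o nB ⟩
      countBelow (λ k → counted JM (k + o)) nB + countBelow (counted JM) o
    ≡⟨ cong₂ _+_ (countBelow-cong _ (counted B) nB countedJ-B)
                 (countBelow-cong (counted JM) (counted A) o countedJ-A) ⟩
      countBelow (counted B) nB + countBelow (counted A) o
    ≡⟨ +-comm (countBelow (counted B) nB) _ ⟩
      countBelow (counted A) o + countBelow (counted B) nB
    ∎
    where open ≡-Reasoning

-- Closing a marked map by the new root edge (darts n and n+1, where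
-- n = 2·edges C).  Four values of σ are redirected; the root face P ++ Q
-- of C splits into the new root face n ∷ P and the face (n+1) ∷ Q, and
-- every other face of C survives.  The face (n+1) ∷ Q has degree 1 + |Q|.

module CloseMap (C : CMap) {P Q : List ℕ} (IC : Marked C P Q) where
  n : ℕ
  n = 2 * edges C
  K : CMap
  K = close C
  N : ℕ
  N = suc (suc n)

  darts-close : 2 * edges K ≡ N
  darts-close = *-suc 2 (edges C)

  injC : InjectiveOn (σ C) n
  injC = IsRotation.inj (Marked.rotation IC)
  intoC : MapsInto (σ C) n
  intoC = IsRotation.into (Marked.rotation IC)

  -- z is the last dart of P (φ z = ★), w the last dart of Q (φ w = R)
  lastP : LastStep (φ C) (root C) P (star C)
  lastP = Seg-last (Marked.fromRoot IC) (Marked.P≢[] IC)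
  open LastStep lastP using () renaming (init to P0; last to z; split to P-split; before to segP0; step to φz; last∈ to z∈P)

  lastQ : LastStep (φ C) (star C) Q (root C)
  lastQ = Seg-last (Marked.toRoot IC) (Marked.Q≢[] IC)
  open LastStep lastQ using () renaming (init to Q0; last to w; split to Q-split; before to segQ0; step to φw; last∈ to w∈Q)

  distinctPQ : Distinct P × Distinct Q × Disjoint P Q
  distinctPQ = distinct-++⁻ P (Marked.distinct IC)
  distinctP : Distinct P
  distinctP = proj₁ distinctPQ
  distinctQ : Distinct Q
  distinctQ = proj₁ (proj₂ distinctPQ)
  P#Q : Disjoint P Q
  P#Q = proj₂ (proj₂ distinctPQ)

  P-bounded : Bounded n P
  P-bounded x m = Marked.bounded IC x (∈-++⁺ˡ m)
  Q-bounded : Bounded n Q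
  Q-bounded x m = Marked.bounded IC x (∈-++⁺ʳ P m)

  z<n : z < n
  z<n = P-bounded z z∈P
  w<n : w < n
  w<n = Q-bounded w w∈Q
  star∈Q : star C ∈ Q
  star∈Q = Seg-start∈ (Marked.toRoot IC) (Marked.Q≢[] IC)
  star<n : star C < n
  star<n = Q-bounded _ star∈Q

  P0-≢z : ∀ x → x ∈ P0 → x ≢ z
  P0-≢z x m refl = proj₂ (proj₂ (distinct-++⁻ P0 (subst Distinct P-split distinctP))) x m (here refl)
  Q0-≢w : ∀ x → x ∈ Q0 → x ≢ w
  Q0-≢w x m refl = proj₂ (proj₂ (distinct-++⁻ Q0 (subst Distinct Q-split distinctQ))) x m (here refl)
  P-≢w : ∀ x → x ∈ P → x ≢ w
  P-≢w x m refl = P#Q x m w∈Q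
  Q-≢z : ∀ x → x ∈ Q → x ≢ z
  Q-≢z x m refl = P#Q x z∈P m

  -- X = flip z and Y = flip w are the old darts whose σ-values change
  X : ℕ
  X = pre (σ C) (star C) n
  X≡ : X ≡ flip z
  X≡ = pre-correct (σ C) (star C) n (flip z) injC (flip-bounded (edges C) z z<n) φz
  Y : ℕ
  Y = pre (σ C) (root C) n
  Y≡ : Y ≡ flip w
  Y≡ = pre-correct (σ C) (root C) n (flip w) injC (flip-bounded (edges C) w w<n) φw
  X<n : X < n
  X<n = subst (_< n) (sym X≡) (flip-bounded (edges C) z z<n)
  Y<n : Y < n
  Y<n = subst (_< n) (sym Y≡) (flip-bounded (edges C) w w<n)
  X≢Y : X ≢ Y
  X≢Y e = Q-≢z w w∈Q (sym (flip-injective z w (trans (sym X≡) (trans e Y≡))))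

  <n⇒≢n : ∀ {d} → d < n → d ≢ n
  <n⇒≢n = <⇒≢
  <n⇒≢n+1 : ∀ {d} → d < n → d ≢ suc n
  <n⇒≢n+1 lt = <⇒≢ (m<n⇒m<1+n lt)

  σ₁ σ₂ σ₃ : ℕ → ℕ
  σ₁ = update (σ C) X n
  σ₂ = update σ₁ n (star C)
  σ₃ = update σ₂ Y (suc n)

  σK-n+1 : σ K (suc n) ≡ root C
  σK-n+1 = update-hit σ₃ (suc n) (root C)
  σK-Y : σ K Y ≡ suc n
  σK-Y = trans (update-miss σ₃ (suc n) (root C) Y (<n⇒≢n+1 Y<n)) (update-hit σ₂ Y (suc n))
  σK-n : σ K n ≡ star C
  σK-n = trans (update-miss σ₃ (suc n) (root C) n (<⇒≢ (n<1+n n)))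
           (trans (update-miss σ₂ Y (suc n) n (λ e → <n⇒≢n Y<n (sym e))) (update-hit σ₁ n (star C)))
  σK-X : σ K X ≡ n
  σK-X = trans (update-miss σ₃ (suc n) (root C) X (<n⇒≢n+1 X<n))
           (trans (update-miss σ₂ Y (suc n) X X≢Y)
             (trans (update-miss σ₁ n (star C) X (<n⇒≢n X<n)) (update-hit (σ C) X n)))
  σK-other : ∀ d → d ≢ suc n → d ≢ Y → d ≢ n → d ≢ X → σ K d ≡ σ C d
  σK-other d d≢n+1 d≢Y d≢n d≢X = trans (update-miss σ₃ (suc n) (root C) d d≢n+1)
           (trans (update-miss σ₂ Y (suc n) d d≢Y)
             (trans (update-miss σ₁ n (star C) d d≢n) (update-miss (σ C) X n d d≢X)))

  extended : ℕ → ℕ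
  extended d = if d <ᵇ n then σ C d else d
  extended-old : ∀ d → d < n → extended d ≡ σ C d
  extended-old d lt = if-true (dec-true (d <? n) lt)
  extended-new : ∀ d → ¬ d < n → extended d ≡ d
  extended-new d nl = if-false (dec-false (d <? n) nl)

  extended-inj : InjectiveOn extended N
  extended-inj a b _ _ e with a <? n | b <? n
  ... | yes a<n | yes b<n = injC a b a<n b<n (trans (sym (extended-old a a<n)) (trans e (extended-old b b<n)))
  ... | yes a<n | no b≮n =
    contradiction (subst (_< n) (trans (sym (extended-old a a<n)) (trans e (extended-new b b≮n))) (intoC a a<n)) b≮n
  ... | no a≮n | yes b<n =
    contradiction (subst (_< n) (trans (sym (extended-old b b<n)) (trans (sym e) (extended-new a a≮n))) (intoC b b<n)) a≮n
  ... | no a≮n | no b≮n = trans (sym (extended-new a a≮n)) (trans e (extended-new b b≮n))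

  extended-into : MapsInto extended N
  extended-into d d<N with d <? n
  ... | yes d<n = subst (_< N) (sym (extended-old d d<n)) (m<n⇒m<1+n (m<n⇒m<1+n (intoC d d<n)))
  ... | no d≮n = subst (_< N) (sym (extended-new d d≮n)) d<N

  X<N : X < N
  X<N = m<n⇒m<1+n (m<n⇒m<1+n X<n)
  Y<N : Y < N
  Y<N = m<n⇒m<1+n (m<n⇒m<1+n Y<n)
  n<N : n < N
  n<N = m<n⇒m<1+n (n<1+n n)
  n+1<N : suc n < N
  n+1<N = n<1+n (suc n)

  -- σ_K is the extension composed with two transpositions
  swapped : ℕ → ℕ
  swapped d = extended (swap X n (swap Y (suc n) d))

  swapped-n+1 : swapped (suc n) ≡ root C
  swapped-n+1 = begin
    extended (swap X n (swap Y (suc n) (suc n)))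
      ≡⟨ cong (λ t → extended (swap X n t)) (swap-b Y (suc n) (≢-sym (<n⇒≢n+1 Y<n))) ⟩
    extended (swap X n Y)
      ≡⟨ cong extended (swap-other X n Y (≢-sym X≢Y) (<n⇒≢n Y<n)) ⟩
    extended Y                                   ≡⟨ extended-old Y Y<n ⟩
    σ C Y                                        ≡⟨ cong (σ C) Y≡ ⟩
    φ C w                                        ≡⟨ φw ⟩
    root C                                       ∎
    where open ≡-Reasoning

  swapped-Y : swapped Y ≡ suc n
  swapped-Y = begin
    extended (swap X n (swap Y (suc n) Y)) ≡⟨ cong (λ t → extended (swap X n t)) (swap-a Y (suc n)) ⟩
    extended (swap X n (suc n))
      ≡⟨ cong extended (swap-other X n (suc n) (≢-sym (<n⇒≢n+1 X<n)) (≢-sym (<⇒≢ (n<1+n n)))) ⟩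
    extended (suc n)                       ≡⟨ extended-new (suc n) (λ l → <⇒≱ l (n≤1+n n)) ⟩
    suc n                                  ∎
    where open ≡-Reasoning

  swapped-n : swapped n ≡ star C
  swapped-n = begin
    extended (swap X n (swap Y (suc n) n))
      ≡⟨ cong (λ t → extended (swap X n t)) (swap-other Y (suc n) n (≢-sym (<n⇒≢n Y<n)) (<⇒≢ (n<1+n n))) ⟩
    extended (swap X n n)                  ≡⟨ cong extended (swap-b X n (≢-sym (<n⇒≢n X<n))) ⟩
    extended X                             ≡⟨ extended-old X X<n ⟩
    σ C X                                  ≡⟨ cong (σ C) X≡ ⟩
    φ C z                                  ≡⟨ φz ⟩
    star C                                 ∎
    where open ≡-Reasoning

  swapped-X : swapped X ≡ n
  swapped-X = begin
    extended (swap X n (swap Y (suc n) X))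
      ≡⟨ cong (λ t → extended (swap X n t)) (swap-other Y (suc n) X X≢Y (<n⇒≢n+1 X<n)) ⟩
    extended (swap X n X)                  ≡⟨ cong extended (swap-a X n) ⟩
    extended n                             ≡⟨ extended-new n (n≮n n) ⟩
    n                                      ∎
    where open ≡-Reasoning

  swapped-old : ∀ d → d < N → d ≢ suc n → d ≢ Y → d ≢ n → d ≢ X → swapped d ≡ σ C d
  swapped-old d d<N d≢n+1 d≢Y d≢n d≢X = begin
    extended (swap X n (swap Y (suc n) d))
      ≡⟨ cong (λ t → extended (swap X n t)) (swap-other Y (suc n) d d≢Y d≢n+1) ⟩
    extended (swap X n d)                  ≡⟨ cong extended (swap-other X n d d≢X d≢n) ⟩
    extended d                             ≡⟨ extended-old d (<2+⇒< d<N d≢n+1 d≢n) ⟩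
    σ C d                                  ∎
    where open ≡-Reasoning

  σK-swapped : ∀ d → d < N → σ K d ≡ swapped d
  σK-swapped d d<N with d ≟ suc n | d ≟ Y | d ≟ n | d ≟ X
  ... | yes refl | _ | _ | _ = trans σK-n+1 (sym swapped-n+1)
  ... | no _ | yes refl | _ | _ = trans σK-Y (sym swapped-Y)
  ... | no _ | no _ | yes refl | _ = trans σK-n (sym swapped-n)
  ... | no _ | no _ | no _ | yes refl = trans σK-X (sym swapped-X)
  ... | no d≢n+1 | no d≢Y | no d≢n | no d≢X =
    trans (σK-other d d≢n+1 d≢Y d≢n d≢X) (sym (swapped-old d d<N d≢n+1 d≢Y d≢n d≢X))

  rotation : IsRotation K
  rotation = record
    { into = subst (MapsInto (σ K)) (sym darts-close) λ d d<N → subst (_< N) (sym (σK-swapped d d<N))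
               (extended-into _ (swap-bounded X n _ N X<N n<N (swap-bounded Y (suc n) d N Y<N n+1<N d<N)))
    ; inj = subst (InjectiveOn (σ K)) (sym darts-close)
              (injectiveOn-swap (λ d → extended (swap X n d)) (σ K) Y (suc n) N
                (injectiveOn-swap extended _ X n N extended-inj X<N n<N (λ d _ → refl)) Y<N n+1<N σK-swapped) }

  φK-z : φ K z ≡ n
  φK-z = trans (cong (σ K) (sym X≡)) σK-X
  φK-w : φ K w ≡ suc n
  φK-w = trans (cong (σ K) (sym Y≡)) σK-Y
  φK-n : φ K n ≡ root C
  φK-n = trans (cong (σ K) (flip-even (edges C))) σK-n+1
  φK-n+1 : φ K (suc n) ≡ star C
  φK-n+1 = trans (cong (σ K) (flip-odd (edges C))) σK-n
  φK-other : ∀ d → d < n → d ≢ z → d ≢ w → φ K d ≡ φ C d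
  φK-other d d<n d≢z d≢w =
    σK-other (flip d) (<n⇒≢n+1 fd<n) (λ e → d≢w (flip-injective d w (trans e Y≡))) (<n⇒≢n fd<n)
             (λ e → d≢z (flip-injective d z (trans e X≡)))
    where
    fd<n : flip d < n
    fd<n = flip-bounded (edges C) d d<n

  rootOrbit : Seg (φ K) n (n ∷ P) n
  rootOrbit = cons (subst (λ t → Seg (φ K) t P n) (sym φK-n)
                (subst (λ L → Seg (φ K) (root C) L n) (sym P-split)
                  (Seg-++ (Seg-cong segP0 unchanged) (cons (subst (λ t → Seg (φ K) t [] n) (sym φK-z) nil)))))
    where
    unchanged : ∀ x → x ∈ P0 → φ K x ≡ φ C x
    unchanged x m = φK-other x (P-bounded x x∈P) (P0-≢z x m) (P-≢w x x∈P)
      where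
      x∈P : x ∈ P
      x∈P = subst (x ∈_) (sym P-split) (∈-++⁺ˡ m)

  innerOrbit : Seg (φ K) (suc n) (suc n ∷ Q) (suc n)
  innerOrbit = cons (subst (λ t → Seg (φ K) t Q (suc n)) (sym φK-n+1)
                 (subst (λ L → Seg (φ K) (star C) L (suc n)) (sym Q-split)
                   (Seg-++ (Seg-cong segQ0 unchanged) (cons (subst (λ t → Seg (φ K) t [] (suc n)) (sym φK-w) nil)))))
    where
    unchanged : ∀ x → x ∈ Q0 → φ K x ≡ φ C x
    unchanged x m = φK-other x (Q-bounded x x∈Q) (Q-≢z x x∈Q) (Q0-≢w x m)
      where
      x∈Q : x ∈ Q
      x∈Q = subst (x ∈_) (sym Q-split) (∈-++⁺ˡ m)

  rootFace : RootFace K (n ∷ P)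
  rootFace = record
    { rotation = rotation ; rest = P ; listed = refl ; orbit = rootOrbit
    ; bounded = subst (λ m → Bounded m (n ∷ P)) (sym darts-close) bounded
    ; distinct = fresh (λ m → <n⇒≢n (P-bounded n m) refl) distinctP
    ; short = subst (suc (length P) ≤_) (sym darts-close)
                (s≤s (m≤n⇒m≤1+n (≤-trans (m≤m+n (length P) (length Q)) (Marked.short IC)))) }
    where
    bounded : Bounded N (n ∷ P)
    bounded x (here refl) = n<N
    bounded x (there m) = m<n⇒m<1+n (m<n⇒m<1+n (P-bounded x m))

  faceC : RootFace C (P ++ Q)
  faceC = markedRootFace IC

  -- the two new darts: n is on the root face and n+1 is not below φ (n+1)
  internal2Faces-close : internal2Faces K ≡ countBelow (counted K) n
  internal2Faces-close = trans (cong (countBelow (counted K)) darts-close)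
    (cong₂ (λ a b → (if a then 1 else 0) + ((if b then 1 else 0) + countBelow (counted K) n))
           n+1-notCounted (rootFace-notCounted rootFace (here refl)))
    where
    n+1-notCounted : counted K (suc n) ≡ false
    n+1-notCounted = trans (cong (onInternal2Face K (suc n) ∧_) notBelow) (∧-zeroʳ (onInternal2Face K (suc n)))
      where
      notBelow : (suc n <ᵇ φ K (suc n)) ≡ false
      notBelow = trans (cong (suc n <ᵇ_) φK-n+1)
                   (dec-false (suc n <? star C) (λ l → <⇒≱ l (≤-trans (<⇒≤ star<n) (n≤1+n n))))

  countedK-old : ∀ d → d < n → d ∉ P ++ Q → counted K d ≡ counted C d
  countedK-old d d<n d∉ = faceTest-cong (cong (_≡ᵇ d) φd) (cong (_≡ᵇ d) φφd)
      (trans (rootFace-out rootFace d∉K) (sym (rootFace-out faceC d∉))) (cong (d <ᵇ_) φd)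
    where
    avoids : ∀ {x} → x ∉ P ++ Q → x ≢ z × x ≢ w
    avoids x∉ = (λ e → x∉ (subst (_∈ _) (sym e) (∈-++⁺ˡ z∈P))) , (λ e → x∉ (subst (_∈ _) (sym e) (∈-++⁺ʳ P w∈Q)))
    φd : φ K d ≡ φ C d
    φd = φK-other d d<n (proj₁ (avoids d∉)) (proj₂ (avoids d∉))
    φd∉ : φ C d ∉ P ++ Q
    φd∉ m = d∉ (rootFace-backClosed faceC d<n m)
    φφd : φ K (φ K d) ≡ φ C (φ C d)
    φφd = trans (cong (φ K) φd)
                (φK-other (φ C d) (φ-mapsInto C intoC d d<n) (proj₁ (avoids φd∉)) (proj₂ (avoids φd∉)))
    d∉K : d ∉ n ∷ P
    d∉K (here e) = <n⇒≢n d<n e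
    d∉K (there m) = d∉ (∈-++⁺ˡ m)

  -- darts of P lie on both root faces
  countedK-P : ∀ {d} → d ∈ P → counted K d ≡ counted C d
  countedK-P d∈ = trans (rootFace-notCounted rootFace (there d∈)) (sym (rootFace-notCounted faceC (∈-++⁺ˡ d∈)))

  -- if |Q| ≥ 2 the new inner face has degree ≥ 3, so nothing changes
  internal2Faces-close-long : 2 ≤ length Q → internal2Faces K ≡ internal2Faces C
  internal2Faces-close-long |Q|≥2 = trans internal2Faces-close (countBelow-cong (counted K) (counted C) n same)
    where
    K-bounded : Bounded N (suc n ∷ Q)
    K-bounded x (here refl) = n+1<N
    K-bounded x (there k) = m<n⇒m<1+n (m<n⇒m<1+n (Q-bounded x k))
    countedK-Q : ∀ {d} → d ∈ Q → counted K d ≡ counted C d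
    countedK-Q {d} d∈ = trans (trans (faceTest-cong {a = fixed} {r = onRoot} {l = below} refl
                                        (dec-false (φ K (φ K d) ≟ d) no2Cycle) refl refl)
                                     (faceTest-notTwoCycle fixed onRoot below))
                              (sym (rootFace-notCounted faceC (∈-++⁺ʳ P d∈)))
      where
      fixed onRoot below : Bool
      fixed = φ K d ≡ᵇ d
      onRoot = inRootFace K d
      below = d <ᵇ φ K d
      no2Cycle : φ K (φ K d) ≢ d
      no2Cycle = longCycle⇒no2Cycle innerOrbit (fresh (λ k → <n⇒≢n+1 (Q-bounded _ k) refl) distinctQ) |Q|≥2
                   (subst (MapsInto (φ K)) darts-close (φ-mapsInto K (IsRotation.into rotation)))
                   (subst (InjectiveOn (φ K)) darts-close (φ-injectiveOn K (IsRotation.inj rotation)))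
                   K-bounded (there d∈)
    same : ∀ d → d < n → counted K d ≡ counted C d
    same d d<n with d ∈? P | d ∈? Q
    ... | yes d∈P | _ = countedK-P d∈P
    ... | no _ | yes d∈Q = countedK-Q d∈Q
    ... | no d∉P | no d∉Q = countedK-old d d<n (λ k → [ d∉P , d∉Q ]′ (∈-++⁻ P k))

  -- if Q = (★) the new inner face {★, n+1} is an internal 2-face,
  -- counted at ★
  internal2Faces-close-short : length Q ≡ 1 → internal2Faces K ≡ 1 + internal2Faces C
  internal2Faces-close-short |Q|≡1 = trans internal2Faces-close
    (countBelow-one (counted K) (counted C) n s star<n countedK-s (rootFace-notCounted faceC (∈-++⁺ʳ P star∈Q)) same)
    where
    s : ℕ
    s = star C
    Q≡s : Q ≡ s ∷ []
    Q≡s with singleton Q |Q|≡1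
    ... | x , Q≡x = trans Q≡x (cong (_∷ []) (Seg-head (subst (λ L → Seg (φ C) s L (root C)) Q≡x (Marked.toRoot IC))))
    φs : φ K s ≡ suc n
    φs = trans (cong (φ K) (sym w≡s)) φK-w
      where
      w≡s : w ≡ s
      w≡s with subst (w ∈_) Q≡s w∈Q
      ... | here e = e
    countedK-s : counted K s ≡ true
    countedK-s = faceTest-cong (trans (cong (_≡ᵇ s) φs) (dec-false (suc n ≟ s) (λ e → <n⇒≢n+1 star<n (sym e))))
                   (trans (cong (_≡ᵇ s) (trans (cong (φ K) φs) φK-n+1)) (dec-true (s ≟ s) refl))
                   (rootFace-out rootFace s∉)
                   (trans (cong (s <ᵇ_) φs) (dec-true (s <? suc n) (m<n⇒m<1+n star<n)))
      where
      s∉ : s ∉ n ∷ P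
      s∉ (here e) = <n⇒≢n star<n e
      s∉ (there m) = P#Q s m star∈Q
    same : ∀ d → d < n → d ≢ s → counted K d ≡ counted C d
    same d d<n d≢s with d ∈? P | d ∈? Q
    ... | yes d∈P | _ = countedK-P d∈P
    ... | no _ | yes d∈Q with subst (d ∈_) Q≡s d∈Q
    ...   | here e = contradiction e d≢s
    same d d<n d≢s | no d∉P | no d∉Q = countedK-old d d<n (λ k → [ d∉P , d∉Q ]′ (∈-++⁻ P k))

length-take-≤ : ∀ i (L : List ℕ) → i ≤ length L → length (take i L) ≡ i
length-take-≤ i L i≤ = trans (length-take i L) (m≤n⇒m⊓n≡m i≤)

markSplit : ∀ {K L} i → RootFace K L → 1 ≤ i → i < length L → Marked (mark i K) (take i L) (drop i L)
markSplit {K} {L} i R 1≤i i<len = record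
  { rotation = record { into = IsRotation.into (RootFace.rotation R) ; inj = IsRotation.inj (RootFace.rotation R) }
  ; fromRoot = subst (λ j → Seg (φ K) (root K) (take i L) (iter (φ K) j (root K))) |take| (proj₁ split)
  ; toRoot = subst (λ j → Seg (φ K) (iter (φ K) j (root K)) (drop i L) (root K)) |take| (proj₂ split)
  ; P≢[] = λ e → <⇒≢ 1≤i (trans (sym (cong length e)) |take|)
  ; Q≢[] = λ e → m<n⇒n≢0 (m<n⇒0<n∸m i<len) (trans (sym (length-drop i L)) (cong length e))
  ; bounded = subst (Bounded (2 * edges K)) (sym L≡) (RootFace.bounded R)
  ; distinct = subst Distinct (sym L≡) (RootFace.distinct R)
  ; short = subst (_≤ 2 * edges K) (trans (cong length (sym L≡)) (length-++ (take i L))) (RootFace.short R) }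
  where
  L≡ : take i L ++ drop i L ≡ L
  L≡ = take++drop≡id i L
  |take| : length (take i L) ≡ i
  |take| = length-take-≤ i L (<⇒≤ i<len)
  orbitL : Seg (φ K) (root K) L (root K)
  orbitL = subst (λ t → Seg (φ K) (root K) t (root K)) (sym (RootFace.listed R)) (RootFace.orbit R)
  split : Seg (φ K) (root K) (take i L) (iter (φ K) (length (take i L)) (root K))
        × Seg (φ K) (iter (φ K) (length (take i L)) (root K)) (drop i L) (root K)
  split = Seg-split (take i L) (subst (λ t → Seg (φ K) (root K) t (root K)) (sym L≡) orbitL)

-- the length of the part of the root face of M(t) from ★ back to R
returnLength : Tree → ℕ
returnLength t = suc (maxLabel t ∸ label t)

returnLengths : List Tree → ℕ
returnLengths [] = 0
returnLengths (t ∷ ts) = returnLength t + returnLengths ts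

label≤maxLabel : ∀ t → NonRootOK t → label t ≤ maxLabel t
label≤maxLabel (node i []) refl = ≤-refl
label≤maxLabel (node i (c ∷ cs)) (_ , i≤sum , _) = i≤sum

record Shape (M : CMap) (p q c : ℕ) : Set where
  field
    {P Q}  : List ℕ
    marked : Marked M P Q
    |P|    : length P ≡ p
    |Q|    : length Q ≡ q
    faces  : internal2Faces M ≡ c

reshape : ∀ {M p q c p' q' c'} → p ≡ p' → q ≡ q' → c ≡ c' → Shape M p q c → Shape M p' q' c'
reshape refl refl refl S = S

leafShape : Shape leafMap 1 1 0
leafShape = record
  { marked = record
      { rotation = record { into = λ d d<2 → d<2 ; inj = λ a b _ _ e → e }
      ; fromRoot = cons nil ; toRoot = cons nil ; P≢[] = λ () ; Q≢[] = λ ()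
      ; bounded = bounded ; distinct = fresh (λ { (here ()) ; (there ()) }) (fresh (λ ()) done)
      ; short = ≤-refl }
  ; |P| = refl ; |Q| = refl ; faces = refl }
  where
  bounded : Bounded 2 (0 ∷ 1 ∷ [])
  bounded _ (here refl) = s≤s z≤n
  bounded _ (there (here refl)) = s≤s (s≤s z≤n)

joinShape : ∀ {A B p q c p' q' c'} → Shape A p q c → Shape B p' q' c' →
  Shape (join A B) (p + p') (q + q') (c + c')
joinShape {A} {B} {q = q} {q' = q'} SA SB = record
  { marked = marked
  ; |P| = trans (length-++ PA) (cong₂ _+_ (Shape.|P| SA) (trans (length-map (_+ o) PB) (Shape.|P| SB)))
  ; |Q| = trans (length-++ QB')
            (trans (cong₂ _+_ (trans (length-map (_+ o) QB) (Shape.|Q| SB)) (Shape.|Q| SA)) (+-comm q' q))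
  ; faces = trans internal2Faces-join (cong₂ _+_ (Shape.faces SA) (Shape.faces SB)) }
  where
  open JoinMaps A B (Shape.marked SA) (Shape.marked SB)
  PA PB QB : List ℕ
  PA = Shape.P SA
  PB = Shape.P SB
  QB = Shape.Q SB

closeFaces : ∀ i u us → NonRootOK u → ∀ {C p} →
  Shape C p (returnLength u + returnLengths us) (countOnlyMax u + countOnlyMaxL us) →
  internal2Faces (close C) ≡ countOnlyMax (node i (u ∷ us))
closeFaces i u [] okU {C} S with label u ≡ᵇ maxLabel u in eq
... | true = trans (internal2Faces-close-short |Q|≡1) (cong suc (trans (Shape.faces S) (+-identityʳ _)))
  where
  open CloseMap C (Shape.marked S)
  |Q|≡1 : length (Shape.Q S) ≡ 1
  |Q|≡1 = trans (Shape.|Q| S) (trans (+-identityʳ _)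
            (cong suc (trans (cong (_∸ label u) (sym (≡ᵇ-true⇒≡ _ _ eq))) (n∸n≡0 (label u)))))
... | false = trans (internal2Faces-close-long |Q|≥2) (trans (Shape.faces S) (+-identityʳ _))
  where
  open CloseMap C (Shape.marked S)
  u<max : label u < maxLabel u
  u<max = ≤∧≢⇒< (label≤maxLabel u okU) (≡ᵇ-false⇒≢ _ _ eq)
  |Q|≥2 : 2 ≤ length (Shape.Q S)
  |Q|≥2 = subst (2 ≤_) (sym (trans (Shape.|Q| S) (+-identityʳ _))) (s≤s (m<n⇒0<n∸m u<max))
closeFaces i u (v ∷ vs) okU {C} S = trans (internal2Faces-close-long |Q|≥2) (Shape.faces S)
  where
  open CloseMap C (Shape.marked S)
  |Q|≥2 : 2 ≤ length (Shape.Q S)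
  |Q|≥2 = subst (2 ≤_) (sym (Shape.|Q| S))
            (s≤s (≤-trans (s≤s z≤n) (m≤n+m (returnLength v + returnLengths vs) (maxLabel u ∸ label u))))

mutual
  nodeShape : ∀ t → NonRootOK t → Shape (Mv t) (label t) (returnLength t) (countOnlyMax t)
  nodeShape (node i []) refl = leafShape
  nodeShape (node i (u ∷ us)) (1≤i , i≤S , okU , okUs) = record
    { marked = markSplit i (CloseMap.rootFace C (Shape.marked SC)) 1≤i (s≤s (subst (i ≤_) (sym (Shape.|P| SC)) i≤S))
    ; |P| = length-take-≤ i (n ∷ P) (subst (i ≤_) (sym (cong suc (Shape.|P| SC))) (m≤n⇒m≤1+n i≤S))
    ; |Q| = trans (length-drop i (n ∷ P)) (trans (cong (λ l → suc l ∸ i) (Shape.|P| SC)) (+-∸-assoc 1 i≤S))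
    ; faces = closeFaces i u us okU SC }
    where
    C : CMap
    C = chain (Mv u) (Ms us)
    SC : Shape C (sumLabels (u ∷ us)) (returnLength u + returnLengths us) (countOnlyMax u + countOnlyMaxL us)
    SC = chainShape (nodeShape u okU) us okUs
    n : ℕ
    n = 2 * edges C
    P : List ℕ
    P = Shape.P SC

  chainShape : ∀ {A p q c} → Shape A p q c → ∀ ts → AllOK ts →
    Shape (chain A (Ms ts)) (p + sumLabels ts) (q + returnLengths ts) (c + countOnlyMaxL ts)
  chainShape S [] _ = reshape (sym (+-identityʳ _)) (sym (+-identityʳ _)) (sym (+-identityʳ _)) S
  chainShape {p = p} {q} {c} S (t ∷ ts) (okT , okTs) =
    reshape (+-assoc p (label t) _) (+-assoc q (returnLength t) _) (+-assoc c (countOnlyMax t) _)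
      (chainShape (joinShape S (nodeShape t okT)) ts okTs)

Φ-faces : ∀ T → IsBeta10 T → ∃[ L ] (RootFace (Φ T) L × internal2Faces (Φ T) ≡ countOnlyMax T)
Φ-faces (node i []) _ = _ , markedRootFace (Shape.marked leafShape) , refl
Φ-faces (node i (u ∷ us)) (_ , _ , _ , okU , okUs) =
  _ , CloseMap.rootFace C (Shape.marked SC) , closeFaces i u us okU SC
  where
  C : CMap
  C = chain (Mv u) (Ms us)
  SC : Shape C (sumLabels (u ∷ us)) (returnLength u + returnLengths us) (countOnlyMax u + countOnlyMaxL us)
  SC = chainShape (nodeShape u okU) us okUs

primitive⇒noInternal2Faces : ∀ K → Primitive K → internal2Faces K ≡ 0
primitive⇒noInternal2Faces K prim =
  countBelow-zero (counted K) (2 * edges K) (λ k k<n → cong (_∧ (k <ᵇ φ K k)) (prim k k<n))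

-- an internal 2-face {d, φ d} is counted at the smaller of its two darts
internal2Face-counted : ∀ {K L} → RootFace K L → ∀ d → onInternal2Face K d ≡ true →
  counted K d ≡ true ⊎ counted K (φ K d) ≡ true
internal2Face-counted {K} R d on2 with φ K d ≡ᵇ d in fixed | φ K (φ K d) ≡ᵇ d in twoCycle | inRootFace K d in onRoot
... | false | true | false with d <? φ K d
...   | yes d<f = inj₁ (dec-true (d <? φ K d) d<f)
...   | no d≮f = inj₂ (faceTest-cong
          (trans (cong (_≡ᵇ f) φf≡d) (dec-false (d ≟ f) (λ e → f≢d (sym e))))
          (trans (cong (λ t → φ K t ≡ᵇ f) φf≡d) (dec-true (f ≟ f) refl))
          (rootFace-out R f∉)
          (trans (cong (f <ᵇ_) φf≡d) (dec-true (f <? d) (≤∧≢⇒< (≮⇒≥ d≮f) f≢d))))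
  where
  f : ℕ
  f = φ K d
  f≢d : f ≢ d
  f≢d = ≡ᵇ-false⇒≢ f d fixed
  φf≡d : φ K f ≡ d
  φf≡d = ≡ᵇ-true⇒≡ _ d twoCycle
  f∉ : f ∉ _
  f∉ f∈ with trans (sym (rootFace-in R (subst (_∈ _) φf≡d (rootFace-next R f∈)))) onRoot
  ... | ()
internal2Face-counted R d () | true | _ | _
internal2Face-counted R d () | false | false | _
internal2Face-counted R d () | false | true | true

noInternal2Faces⇒primitive : ∀ {K L} → RootFace K L → internal2Faces K ≡ 0 → Primitive K
noInternal2Faces⇒primitive {K} R none d d<n with onInternal2Face K d in on2
... | false = refl
... | true = [ uncounted d d<n , uncounted (φ K d) φd<n ]′ (internal2Face-counted R d on2)
  where
  φd<n : φ K d < 2 * edges K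
  φd<n = φ-mapsInto K (IsRotation.into (RootFace.rotation R)) d d<n
  uncounted : ∀ e → e < 2 * edges K → counted K e ≡ true → true ≡ false
  uncounted e e<n c = trans (sym c) (countBelow-zero⁻ (counted K) (2 * edges K) none e e<n)

mutual
  hasBad⇒count≢0 : ∀ t → HasBad t → countOnlyMax t ≢ 0
  hasBad⇒count≢0 (node i (u ∷ [])) (here e) rewrite dec-true (label u ≟ maxLabel u) e = λ ()
  hasBad⇒count≢0 (node i (u ∷ [])) (there (here bad)) e =
    hasBad⇒count≢0 u bad (m+n≡0⇒n≡0 (if label u ≡ᵇ maxLabel u then 1 else 0) e)
  hasBad⇒count≢0 (node i (u ∷ v ∷ us)) (there bad) = anyBad⇒count≢0 (u ∷ v ∷ us) bad

  anyBad⇒count≢0 : ∀ ts → Any HasBad ts → countOnlyMaxL ts ≢ 0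
  anyBad⇒count≢0 (t ∷ ts) (here bad) e = hasBad⇒count≢0 t bad (m+n≡0⇒m≡0 (countOnlyMax t) e)
  anyBad⇒count≢0 (t ∷ ts) (there bad) e = anyBad⇒count≢0 ts bad (m+n≡0⇒n≡0 (countOnlyMax t) e)

mutual
  count≢0⇒hasBad : ∀ t → countOnlyMax t ≢ 0 → HasBad t
  count≢0⇒hasBad (node i []) ne = contradiction refl ne
  count≢0⇒hasBad (node i (u ∷ [])) ne with label u ≡ᵇ maxLabel u in eq
  ... | true = here (≡ᵇ-true⇒≡ _ _ eq)
  ... | false = there (here (count≢0⇒hasBad u ne))
  count≢0⇒hasBad (node i (u ∷ v ∷ us)) ne = there (count≢0⇒anyBad (u ∷ v ∷ us) ne)

  count≢0⇒anyBad : ∀ ts → countOnlyMaxL ts ≢ 0 → Any HasBad ts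
  count≢0⇒anyBad [] ne = contradiction refl ne
  count≢0⇒anyBad (t ∷ ts) ne with countOnlyMax t ≟ 0
  ... | yes e = there (count≢0⇒anyBad ts (λ e' → ne (trans (cong (_+ countOnlyMaxL ts) e) e')))
  ... | no t≢0 = here (count≢0⇒hasBad t t≢0)

noBad⇒count≡0 : ∀ t → ¬ HasBad t → countOnlyMax t ≡ 0
noBad⇒count≡0 t noBad with countOnlyMax t ≟ 0
... | yes e = e
... | no ne = contradiction (count≢0⇒hasBad t ne) noBad

proposition2 : (T : Tree) → IsBeta10 T →
    ((Primitive (Φ T) → ¬ HasBad T) × (¬ HasBad T → Primitive (Φ T)))
    × (internal2Faces (Φ T) ≡ countOnlyMax T)
proposition2 T β with Φ-faces T β
... | _ , R , faces = (primitive⇒noBad , noBad⇒primitive) , faces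
  where
  primitive⇒noBad : Primitive (Φ T) → ¬ HasBad T
  primitive⇒noBad prim bad =
    hasBad⇒count≢0 T bad (trans (sym faces) (primitive⇒noInternal2Faces (Φ T) prim))
  noBad⇒primitive : ¬ HasBad T → Primitive (Φ T)
  noBad⇒primitive noBad = noInternal2Faces⇒primitive R (trans faces (noBad⇒count≡0 T noBad))
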